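{- Let $r\geq 2$, $n\geq 2r+1$ and $k\geq 2$. If $D$ is a $k$-tuple dominating set of $K(n,r)$, then $D$ (viewed as a set of $r$-subsets of $[n]\subseteq[n+1]$) is a $k$-tuple dominating set of $K(n+1,r)$. Consequently, $\gamma_{\times k}(K(n+1,r))\leq \gamma_{\times k}(K(n,r))$ for every such $n$ for which $\gamma_{\times k}(K(n,r))$ is defined.
   Context: The Kneser graph $K(n,r)$ has as vertices the $r$-subsets of $[n]=\{1,\dots,n\}$, two vertices adjacent iff disjoint. For a vertex $v$, $N[v]$ is its closed neighbourhood. A set $D$ of vertices is a $k$-tuple dominating set if $|N[v]\cap D|\geq k$ for every vertex $v$; $\gamma_{\times k}(K(n,r))$ is the minimum cardinality of such a set (defined when $k\leq \binom{n-r}{r}+1$). -}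

module Defs where

open import Data.Nat using (ℕ; suc; _≤_)
open import Data.Bool using (Bool)
open import Data.Bool.Properties using () renaming (_≟_ to _≟ᵇ_)
open import Data.Fin.Subset using (Subset; _∩_; ⊥; ∣_∣; outside)
open import Data.Vec using (_∷ʳ_)
open import Data.Vec.Properties using (≡-dec)
open import Data.List using (List; length; filter; map)
open import Data.List.Relation.Unary.All using (All)
open import Data.List.Relation.Unary.Unique.Propositional using (Unique)
open import Data.Sum using (_⊎_)
open import Relation.Binary.PropositionalEquality using (_≡_)
open import Relation.Nullary using (Dec)
open import Relation.Nullary.Decidable using (_⊎-dec_)

IsVertex : (n r : ℕ) → Subset n → Set
IsVertex n r v = ∣ v ∣ ≡ r

-- Adjacency in the Kneser graph: disjointness.
Disjoint : ∀ {n} → Subset n → Subset n → Set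
Disjoint u v = u ∩ v ≡ ⊥

InClosedNbr : ∀ {n} → Subset n → Subset n → Set
InClosedNbr v u = u ≡ v ⊎ Disjoint u v

inClosedNbr? : ∀ {n} (v u : Subset n) → Dec (InClosedNbr v u)
inClosedNbr? v u = ≡-dec _≟ᵇ_ u v ⊎-dec ≡-dec _≟ᵇ_ (u ∩ v) ⊥

IsVertexSet : (n r : ℕ) → List (Subset n) → Set
IsVertexSet n r D = Unique D × All (IsVertex n r) D
  where open import Data.Product using (_×_)

nbrCount : ∀ {n} → Subset n → List (Subset n) → ℕ
nbrCount v D = length (filter (inClosedNbr? v) D)

IsKTupleDom : (n r k : ℕ) → List (Subset n) → Set
IsKTupleDom n r k D =
  IsVertexSet n r D × ((v : Subset n) → IsVertex n r v → k ≤ nbrCount v D)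
  where open import Data.Product using (_×_)

-- γ_{×k}(K(n,r)) is defined and equals m: some k-tuple dominating set has
-- cardinality m and every k-tuple dominating set has cardinality ≥ m.
IsGammaK : (n r k m : ℕ) → Set
IsGammaK n r k m =
  Σ (List (Subset n)) (λ D → IsKTupleDom n r k D × length D ≡ m)
  × ((D : List (Subset n)) → IsKTupleDom n r k D → m ≤ length D)
  where open import Data.Product using (Σ; _×_)

-- View an r-subset of [n] as an r-subset of [n+1] (element n+1 not included).
embed : ∀ {n} → Subset n → Subset (suc n)
embed v = v ∷ʳ outside

embedSet : ∀ {n} → List (Subset n) → List (Subset (suc n))
embedSet = map embed

{-# OPTIONS --safe #-}
-- A vertex of K(n+1,r) avoiding n+1 sees the embedded D exactly as it sees D in K(n,r).
-- A vertex w ∪ {n+1} with |w| = r-1 is dominated by the members of D disjoint from w.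
-- For x ∉ w the vertex w ∪ {x} of K(n,r) has k neighbours in D, at most one of them
-- itself, so at least k-1 members of D avoid both w and x. As k ≥ 2, some u₀ ∈ D
-- avoids w; taking x ∈ u₀, these k-1 members together with u₀ give k members of D
-- disjoint from w.
module Submission where

open import Defs
open import Data.Nat using (ℕ; suc; _≤_; _*_; _+_)
open import Data.Fin.Subset using (Subset)
open import Data.List using (List)
open import Data.Product using (_×_)

open import Data.Nat using (_<_; z≤n; s≤s; s≤s⁻¹)
open import Data.Nat.Properties
open import Data.Bool using (true; false)
open import Data.Bool.Properties using () renaming (_≟_ to _≟ᵇ_)
open import Data.Fin.Subset using (_∩_; _∪_; ⊥; ∣_∣; outside; inside; ⁅_⁆; _∈_; _∉_; Nonempty)
open import Data.Fin.Subset.Properties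
  using (x∈p∩q⁺; x∈p∩q⁻; x∈p∪q⁺; x∈⁅x⁆; ∉⊥; _∈?_; Empty-unique; nonempty?; ∣⊥∣≡0;
         ∣∁p∣≡n∸∣p∣; x∈∁p⇒x∉p; ∪-identityʳ)
import Data.Fin as Fin
open import Data.Vec using ([]; _∷_; _∷ʳ_; initLast; here; there)
open import Data.Vec.Properties using (≡-dec; ∷-injectiveˡ; ∷-injectiveʳ; ∷ʳ-injectiveˡ)
open import Data.List using (filter; length; map; _∷_; [])
open import Data.List.Properties using (length-map; length-filter; filter-notAll)
open import Data.List.Membership.Propositional using (lose) renaming (_∈_ to _∈ₗ_)
open import Data.List.Membership.Propositional.Properties using (∈-filter⁻)
open import Data.List.Relation.Unary.Any using (here)
open import Data.List.Relation.Unary.All as All using (All; _∷_; [])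
open import Data.List.Relation.Unary.All.Properties using (all-filter) renaming (map⁺ to All-map⁺)
open import Data.List.Relation.Unary.Unique.Propositional using (Unique; _∷_)
open import Data.List.Relation.Unary.Unique.Propositional.Properties
  using () renaming (filter⁺ to Unique-filter⁺; map⁺ to Unique-map⁺)
open import Data.List.Relation.Binary.Sublist.Propositional using (⊆-refl)
open import Data.List.Relation.Binary.Sublist.Propositional.Properties using (filter⁺; length-mono-≤)
open import Data.Product using (∃-syntax; _,_; proj₁; proj₂)
open import Data.Sum using (inj₁; inj₂)
open import Function using (_∘_)
open import Relation.Binary.PropositionalEquality
open import Relation.Binary.Definitions using (DecidableEquality)
open import Relation.Nullary using (Dec; yes; no; ¬?; contradiction)
open import Relation.Nullary.Decidable using (does; _×-dec_; _⊎-dec_)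
open import Relation.Unary using (Pred; Decidable; _⊆_)

count : ∀ {a p} {A : Set a} {P : Pred A p} → Decidable P → List A → ℕ
count P? xs = length (filter P? xs)

module _ {a p q} {A : Set a} {P : Pred A p} {Q : Pred A q}
         (P? : Decidable P) (Q? : Decidable Q) where

  count-mono : P ⊆ Q → ∀ xs → count P? xs ≤ count Q? xs
  count-mono P⊆Q xs = length-mono-≤ (filter⁺ P? Q? (λ { refl → P⊆Q }) (⊆-refl {x = xs}))

  count-⊎ : ∀ xs → count (λ x → P? x ⊎-dec Q? x) xs ≤ count P? xs + count Q? xs
  count-⊎ [] = z≤n
  count-⊎ (x ∷ xs) with P? x | Q? x | count-⊎ xs
  ... | yes _ | yes _ | ih = s≤s (≤-trans ih (+-monoʳ-≤ (count P? xs) (n≤1+n _)))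
  ... | yes _ | no  _ | ih = s≤s ih
  ... | no  _ | yes _ | ih = ≤-trans (s≤s ih) (≤-reflexive (sym (+-suc _ _)))
  ... | no  _ | no  _ | ih = ih

  count-filter : ∀ xs → count Q? (filter P? xs) ≡ count (λ x → P? x ×-dec Q? x) xs
  count-filter [] = refl
  count-filter (x ∷ xs) with P? x
  ... | no  _ = count-filter xs
  ... | yes _ with Q? x
  ...   | yes _ = cong suc (count-filter xs)
  ...   | no  _ = count-filter xs

module _ {a b q} {A : Set a} {B : Set b} {Q : Pred B q} (Q? : Decidable Q) (f : A → B) where

  count-map : ∀ xs → count Q? (map f xs) ≡ count (Q? ∘ f) xs
  count-map [] = refl
  count-map (x ∷ xs) with does (Q? (f x))
  ... | true  = cong suc (count-map xs)
  ... | false = count-map xs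

  count-map-mono : ∀ {p} {P : Pred A p} (P? : Decidable P) →
                   (∀ {x} → P x → Q (f x)) → ∀ xs → count P? xs ≤ count Q? (map f xs)
  count-map-mono P? P⇒Q∘f xs =
    ≤-trans (count-mono P? (Q? ∘ f) P⇒Q∘f xs) (≤-reflexive (sym (count-map xs)))

length>0⇒∃∈ : ∀ {a} {A : Set a} (xs : List A) → 0 < length xs → ∃[ x ] x ∈ₗ xs
length>0⇒∃∈ (x ∷ _) _ = x , here refl

count-≟-unique : ∀ {a} {A : Set a} (_≟_ : DecidableEquality A) (c : A) {xs} →
                 Unique xs → count (_≟ c) xs ≤ 1
count-≟-unique _≟_ c {xs} xs-unique =
  length-constant (all-filter (_≟ c) xs) (Unique-filter⁺ (_≟ c) xs-unique)
  where
  length-constant : ∀ {ys} → All (_≡ c) ys → Unique ys → length ys ≤ 1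
  length-constant []                 _                 = z≤n
  length-constant (_ ∷ [])           _                 = s≤s z≤n
  length-constant (refl ∷ refl ∷ _) ((x≢y ∷ _) ∷ _) = contradiction refl x≢y

module _ {n : ℕ} where

  Disjoint⇒∉ : ∀ {p q : Subset n} {x} → Disjoint p q → x ∈ p → x ∉ q
  Disjoint⇒∉ p∩q≡⊥ x∈p x∈q = ∉⊥ (subst (_ ∈_) p∩q≡⊥ (x∈p∩q⁺ (x∈p , x∈q)))

  Disjoint-∪⁅⁆⁻ : ∀ (p q : Subset n) x → Disjoint p (q ∪ ⁅ x ⁆) → Disjoint p q × x ∉ p
  Disjoint-∪⁅⁆⁻ p q x disj =
    Empty-unique (λ (y , y∈p∩q) → let y∈p , y∈q = x∈p∩q⁻ p q y∈p∩q in
                                   Disjoint⇒∉ disj y∈p (x∈p∪q⁺ (inj₁ y∈q))) ,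
    λ x∈p → Disjoint⇒∉ disj x∈p (x∈p∪q⁺ (inj₂ (x∈⁅x⁆ x)))

  ∣p∣>0⇒Nonempty : ∀ {p : Subset n} → 0 < ∣ p ∣ → Nonempty p
  ∣p∣>0⇒Nonempty {p} ∣p∣>0 with nonempty? p
  ... | yes nonempty = nonempty
  ... | no  empty    = contradiction (trans (cong ∣_∣ (Empty-unique empty)) (∣⊥∣≡0 n)) (>⇒≢ ∣p∣>0)

  ∣p∣<n⇒∃∉ : ∀ {p : Subset n} → ∣ p ∣ < n → ∃[ x ] x ∉ p
  ∣p∣<n⇒∃∉ {p} ∣p∣<n with ∣p∣>0⇒Nonempty (subst (0 <_) (sym (∣∁p∣≡n∸∣p∣ p)) (m<n⇒0<n∸m ∣p∣<n))
  ... | x , x∈∁p = x , x∈∁p⇒x∉p x∈∁p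

x∉p⇒∣p∪⁅x⁆∣≡1+∣p∣ : ∀ {n} {p : Subset n} {x} → x ∉ p → ∣ p ∪ ⁅ x ⁆ ∣ ≡ suc ∣ p ∣
x∉p⇒∣p∪⁅x⁆∣≡1+∣p∣ {p = inside  ∷ p} {Fin.zero}  x∉p = contradiction here x∉p
x∉p⇒∣p∪⁅x⁆∣≡1+∣p∣ {p = outside ∷ p} {Fin.zero}  _   = cong (suc ∘ ∣_∣) (∪-identityʳ p)
x∉p⇒∣p∪⁅x⁆∣≡1+∣p∣ {p = inside  ∷ p} {Fin.suc x} x∉p = cong suc (x∉p⇒∣p∪⁅x⁆∣≡1+∣p∣ (x∉p ∘ there))
x∉p⇒∣p∪⁅x⁆∣≡1+∣p∣ {p = outside ∷ p} {Fin.suc x} x∉p = x∉p⇒∣p∪⁅x⁆∣≡1+∣p∣ (x∉p ∘ there)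

∣p∷ʳoutside∣≡∣p∣ : ∀ {n} (p : Subset n) → ∣ p ∷ʳ outside ∣ ≡ ∣ p ∣
∣p∷ʳoutside∣≡∣p∣ []            = refl
∣p∷ʳoutside∣≡∣p∣ (inside  ∷ p) = cong suc (∣p∷ʳoutside∣≡∣p∣ p)
∣p∷ʳoutside∣≡∣p∣ (outside ∷ p) = ∣p∷ʳoutside∣≡∣p∣ p

∣p∷ʳinside∣≡1+∣p∣ : ∀ {n} (p : Subset n) → ∣ p ∷ʳ inside ∣ ≡ suc ∣ p ∣
∣p∷ʳinside∣≡1+∣p∣ []            = refl
∣p∷ʳinside∣≡1+∣p∣ (inside  ∷ p) = cong suc (∣p∷ʳinside∣≡1+∣p∣ p)
∣p∷ʳinside∣≡1+∣p∣ (outside ∷ p) = ∣p∷ʳinside∣≡1+∣p∣ p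

Disjoint-∷ʳoutside : ∀ {n} (p q : Subset n) s → Disjoint p q → Disjoint (p ∷ʳ outside) (q ∷ʳ s)
Disjoint-∷ʳoutside []      []      s refl = refl
Disjoint-∷ʳoutside (_ ∷ p) (_ ∷ q) s disj =
  cong₂ _∷_ (∷-injectiveˡ disj) (Disjoint-∷ʳoutside p q s (∷-injectiveʳ disj))

disjoint? : ∀ {n} (p q : Subset n) → Dec (Disjoint p q)
disjoint? p q = ≡-dec _≟ᵇ_ (p ∩ q) ⊥

disjointFrom : ∀ {n} → Subset n → List (Subset n) → List (Subset n)
disjointFrom w = filter (λ u → disjoint? u w)

nbrCount-embed : ∀ {n} (v : Subset n) D → nbrCount v D ≤ nbrCount (embed v) (embedSet D)
nbrCount-embed v = count-map-mono (inClosedNbr? (embed v)) embed (inClosedNbr? v) λ where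
  (inj₁ u≡v)  → inj₁ (cong embed u≡v)
  (inj₂ disj) → inj₂ (Disjoint-∷ʳoutside _ v outside disj)

∣disjointFrom∣≤nbrCount : ∀ {n} (w : Subset n) D →
                          length (disjointFrom w D) ≤ nbrCount (w ∷ʳ inside) (embedSet D)
∣disjointFrom∣≤nbrCount w =
  count-map-mono (inClosedNbr? (w ∷ʳ inside)) embed (λ u → disjoint? u w)
                 (inj₂ ∘ Disjoint-∷ʳoutside _ w inside)

embedSet-IsVertexSet : ∀ {n r D} → IsVertexSet n r D → IsVertexSet (suc n) r (embedSet D)
embedSet-IsVertexSet (D-unique , D-vertices) =
  Unique-map⁺ (∷ʳ-injectiveˡ _ _) D-unique ,
  All-map⁺ (All.map (λ {v} ∣v∣≡r → trans (∣p∷ʳoutside∣≡∣p∣ v) ∣v∣≡r) D-vertices)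

module _ {n r k : ℕ} {D : List (Subset n)} (D-dom : IsKTupleDom n r k D)
         {w : Subset n} (∣w∣+1≡r : suc ∣ w ∣ ≡ r) where

  k≤1+∣disjointFrom-∉∣ : ∀ {x} → x ∉ w →
                         k ≤ suc (count (λ u → ¬? (x ∈? u)) (disjointFrom w D))
  k≤1+∣disjointFrom-∉∣ {x} x∉w = begin
    k                                                           ≤⟨ proj₂ D-dom w′ ∣w′∣≡r ⟩
    nbrCount w′ D                                               ≤⟨ count-⊎ _ _ D ⟩
    count (λ u → ≡-dec _≟ᵇ_ u w′) D + count (λ u → disjoint? u w′) D
      ≤⟨ +-mono-≤ (count-≟-unique (≡-dec _≟ᵇ_) w′ (proj₁ (proj₁ D-dom)))
                  (count-mono _ _ (λ {u} → Disjoint-∪⁅⁆⁻ u w x) D) ⟩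
    suc (count (λ u → disjoint? u w ×-dec ¬? (x ∈? u)) D)       ≡⟨ cong suc (count-filter _ _ D) ⟨
    suc (count (λ u → ¬? (x ∈? u)) (disjointFrom w D))          ∎
    where
    open ≤-Reasoning
    w′ : Subset n
    w′ = w ∪ ⁅ x ⁆
    ∣w′∣≡r : ∣ w′ ∣ ≡ r
    ∣w′∣≡r = trans (x∉p⇒∣p∪⁅x⁆∣≡1+∣p∣ x∉w) ∣w∣+1≡r

  k≤∣disjointFrom∣ : r ≤ n → 2 ≤ k → k ≤ length (disjointFrom w D)
  k≤∣disjointFrom∣ r≤n 2≤k = begin
    k                                    ≤⟨ k≤1+∣disjointFrom-∉∣ x₀∉w ⟩
    suc (count (λ u → ¬? (x₀ ∈? u)) S)   ≤⟨ filter-notAll _ S (lose u₀∈S λ x₀∉u₀ → x₀∉u₀ x₀∈u₀) ⟩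
    length S                             ∎
    where
    open ≤-Reasoning
    S : List (Subset n)
    S = disjointFrom w D

    S-nonempty : 0 < length S
    S-nonempty with ∣p∣<n⇒∃∉ (≤-trans (≤-reflexive ∣w∣+1≡r) r≤n)
    ... | _ , x₁∉w = ≤-trans (s≤s⁻¹ (≤-trans 2≤k (k≤1+∣disjointFrom-∉∣ x₁∉w))) (length-filter _ S)

    u₀ : Subset n
    u₀ = proj₁ (length>0⇒∃∈ S S-nonempty)

    u₀∈S : u₀ ∈ₗ S
    u₀∈S = proj₂ (length>0⇒∃∈ S S-nonempty)

    u₀∈D×u₀∩w≡⊥ : u₀ ∈ₗ D × Disjoint u₀ w
    u₀∈D×u₀∩w≡⊥ = ∈-filter⁻ (λ u → disjoint? u w) u₀∈S

    ∣u₀∣>0 : 0 < ∣ u₀ ∣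
    ∣u₀∣>0 = subst (0 <_) (trans ∣w∣+1≡r (sym (All.lookup (proj₂ (proj₁ D-dom)) (proj₁ u₀∈D×u₀∩w≡⊥)))) (s≤s z≤n)

    x₀ : Fin.Fin n
    x₀ = proj₁ (∣p∣>0⇒Nonempty ∣u₀∣>0)

    x₀∈u₀ : x₀ ∈ u₀
    x₀∈u₀ = proj₂ (∣p∣>0⇒Nonempty ∣u₀∣>0)

    x₀∉w : x₀ ∉ w
    x₀∉w = Disjoint⇒∉ (proj₂ u₀∈D×u₀∩w≡⊥) x₀∈u₀

IsKTupleDom-embedSet : ∀ {n r k D} → r ≤ n → 2 ≤ k →
                       IsKTupleDom n r k D → IsKTupleDom (suc n) r k (embedSet D)
IsKTupleDom-embedSet {n} {r} {k} {D} r≤n 2≤k D-dom = embedSet-IsVertexSet (proj₁ D-dom) , dominated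
  where
  dominated : ∀ v → IsVertex (suc n) r v → k ≤ nbrCount v (embedSet D)
  dominated v ∣v∣≡r with initLast v
  ... | w , outside , refl =
    ≤-trans (proj₂ D-dom w (trans (sym (∣p∷ʳoutside∣≡∣p∣ w)) ∣v∣≡r)) (nbrCount-embed w D)
  ... | w , inside , refl =
    ≤-trans (k≤∣disjointFrom∣ D-dom (trans (sym (∣p∷ʳinside∣≡1+∣p∣ w)) ∣v∣≡r) r≤n 2≤k)
            (∣disjointFrom∣≤nbrCount w D)

theorem12 : (r n k : ℕ) → 2 ≤ r → 2 * r + 1 ≤ n → 2 ≤ k →
    ((D : List (Subset n)) → IsKTupleDom n r k D →
    IsKTupleDom (suc n) r k (embedSet D))
    × ((m m′ : ℕ) → IsGammaK n r k m → IsGammaK (suc n) r k m′ → m′ ≤ m)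
theorem12 r n k _ 2r+1≤n 2≤k = embed-dom , γ-mono
  where
  r≤n : r ≤ n
  r≤n = m+n≤o⇒m≤o r (m+n≤o⇒m≤o (2 * r) 2r+1≤n)

  embed-dom : (D : List (Subset n)) → IsKTupleDom n r k D → IsKTupleDom (suc n) r k (embedSet D)
  embed-dom _ = IsKTupleDom-embedSet r≤n 2≤k

  γ-mono : (m m′ : ℕ) → IsGammaK n r k m → IsGammaK (suc n) r k m′ → m′ ≤ m
  γ-mono m m′ ((D , D-dom , ∣D∣≡m) , _) (_ , m′-minimal) = begin
    m′                    ≤⟨ m′-minimal (embedSet D) (embed-dom D D-dom) ⟩
    length (embedSet D)   ≡⟨ length-map embed D ⟩
    length D              ≡⟨ ∣D∣≡m ⟩
    m                     ∎
    where open ≤-Reasoning
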